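{- Let $\langle S,A\rangle$ be an exact cover instance and let $\langle P,E,\tau\rangle$, $P=\langle\Omega,F,\pi\rangle$, be the persuasion instance constructed from it as described in the context. Then every observation $R\subseteq F$ with $P(E\mid R)\ge\tau$ is such that $\bigcap R$ contains exactly $m-n$ of the worlds $Y_{i,\ell}$.
   Context: An exact cover instance is a pair $\langle S,A\rangle$ with $S=\{s_1,\dots,s_n\}$ finite and $A=\{A_1,\dots,A_k\}$ a set of non-empty, pairwise different subsets of $S$ with $A_1\cup\dots\cup A_k=S$. Let $m=\sum_{i=1}^k|A_i|$. The constructed instance is: $\Omega=\{W_0\}\cup\{X_0\}\cup Y\cup Z$ where $Y=\{Y_{i,\ell}: 1\le i\le k,\ 1\le\ell\le n,\ s_\ell\in A_i\}$ ($m$ worlds) and $Z=\{Z_\ell:1\le\ell\le n\}$ ($n$ worlds); $F=\{F_1,\dots,F_k\}$ with $F_i=\Omega\setminus\{Y_{i,\ell}: s_\ell\in A_i\}\setminus\{Z_\ell: s_\ell\in A_i\}$; $\pi(W_0)=\pi(X_0)=x$, $\pi(Y_{i,\ell})=y$ for all $Y$-worlds, $\pi(Z_\ell)=z$ for all $Z$-worlds, where $x=1/3$, $y=\frac{1-2x}{m(1+2n)}$, $z=2my$; goal $E=\{W_0\}\cup Y$; threshold $\tau=\frac{x+(m-n)y}{2x+(m-n)y}$. For $R\subseteq F$ (an observation), $P(E\mid R)=\pi^*(E\cap\bigcap R)/\pi^*(\bigcap R)$, where $\pi^*(T)=\sum_{\omega\in T}\pi(\omega)$ and $\bigcap\emptyset=\Omega$.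 -}

module Defs where

open import Data.Nat using (ℕ; zero; suc)
open import Data.Integer using (ℤ; +_)
import Data.Integer as ℤ
open import Data.Rational using (ℚ; 0ℚ; 1ℚ; _/_; _÷_; _+_; _*_; _-_; ≢-nonZero)
import Data.Rational as ℚ
open import Data.Bool using (Bool; true; false; _∧_; _∨_; not)
open import Data.Fin using (Fin)
import Data.Fin as Fin
open import Data.Fin.Subset using (Subset; _∈_; ∣_∣)
open import Data.Fin.Subset.Properties using (_∈?_)
open import Data.List using (List; []; _∷_; _++_; concatMap; map; filter; length; allFin; foldr)
open import Data.Vec using (lookup)
open import Relation.Nullary using (yes; no; does)
open import Relation.Unary using (Pred)
import Relation.Binary.PropositionalEquality
import Data.Product
import Data.Nat
import Data.Fin.Subset

-- Total division on ℚ (x ÷ 0 := 0).  Only ever applied to positive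
-- denominators in the construction, except the degenerate case m = 0 for y.
_÷'_ : ℚ → ℚ → ℚ
p ÷' q with q ℚ.≟ 0ℚ
... | yes _  = 0ℚ
... | no q≢0 = _÷_ p q {{≢-nonZero q≢0}}

ℕ→ℚ : ℕ → ℚ
ℕ→ℚ a = (+ a) / 1

sumℕ : List ℕ → ℕ
sumℕ = foldr Data.Nat._+_ 0

allB : {A : Set} → (A → Bool) → List A → Bool
allB p = foldr (λ a b → p a ∧ b) true

sumℚ : List ℚ → ℚ
sumℚ = foldr _+_ 0ℚ

-- The persuasion instance built from an exact cover instance ⟨S, A⟩ with
-- S = {s_1..s_n} (s_ℓ ↔ ℓ : Fin n) and A = (A_1..A_k), A i : Subset n.
module Construction (n k : ℕ) (A : Fin k → Subset n) where

  m : ℕ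
  m = sumℕ (map (λ i → ∣ A i ∣) (allFin k))

  data World : Set where
    W0 : World
    X0 : World
    Y  : (i : Fin k) (ℓ : Fin n) → ℓ ∈ A i → World
    Z  : Fin n → World

  Yrow : Fin k → List World
  Yrow i = concatMap (λ ℓ → yrow ℓ (ℓ ∈? A i)) (allFin n)
    where
    yrow : (ℓ : Fin n) → Relation.Nullary.Dec (ℓ ∈ A i) → List World
    yrow ℓ (yes p) = Y i ℓ p ∷ []
    yrow ℓ (no _)  = []

  Ω : List World
  Ω = W0 ∷ X0 ∷ (concatMap Yrow (allFin k) ++ map Z (allFin n))

  isY : World → Bool
  isY (Y _ _ _) = true
  isY _         = false

  inE : World → Bool
  inE W0          = true
  inE (Y _ _ _)   = true
  inE _           = false

  inF : Fin k → World → Bool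
  inF i W0        = true
  inF i X0        = true
  inF i (Y j ℓ _) = not (does (i Fin.≟ j))
  inF i (Z ℓ)     = not (lookup (A i) ℓ)

  -- membership in ⋂R for an observation R ⊆ F (R given as a subset of
  -- indices {1..k}); ⋂∅ = Ω
  inCap : Subset k → World → Bool
  inCap R ω = allB (λ i → not (lookup R i) ∨ inF i ω) (allFin k)

  x y z : ℚ
  x = + 1 / 3
  y = (1ℚ - (+ 2 / 1) * x) ÷' ℕ→ℚ (m Data.Nat.* (1 Data.Nat.+ 2 Data.Nat.* n))
  z = ℕ→ℚ (2 Data.Nat.* m) * y

  π : World → ℚ
  π W0        = x
  π X0        = x
  π (Y _ _ _) = y
  π (Z _)     = z

  π* : (World → Bool) → ℚ
  π* T = sumℚ (map π (filter (λ ω → T ω Data.Bool.≟ true) Ω))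

  P[E∣_] : Subset k → ℚ
  P[E∣ R ] = π* (λ ω → inE ω ∧ inCap R ω) ÷' π* (inCap R)

  m-n : ℤ
  m-n = (+ m) ℤ.- (+ n)

  τ : ℚ
  τ = (x + (m-n / 1) * y) ÷' ((+ 2 / 1) * x + (m-n / 1) * y)

  #Y∩ : Subset k → ℕ
  #Y∩ R = length (filter (λ ω → (isY ω ∧ inCap R ω) Data.Bool.≟ true) Ω)

record ExactCoverInstance (n k : ℕ) (A : Fin k → Subset n) : Set where
  field
    nonempty  : ∀ i → Data.Fin.Subset.Nonempty (A i)
    distinct  : ∀ i j → A i Relation.Binary.PropositionalEquality.≡ A j → i Relation.Binary.PropositionalEquality.≡ j
    covers    : ∀ (ℓ : Fin n) → Data.Product.∃ λ i → ℓ ∈ A i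

{-# OPTIONS --safe #-}
module Submission where

-- Every weight π(ω) of the construction is an integer multiple of y: π(W0) = π(X0) = u y with
-- u = m(1 + 2n), π(Y) = y and π(Z) = 2m y.  If ⋂R keeps a of the Y-worlds and b of the Z-worlds,
-- then P(E | R) = (u + a) / (2u + a + 2m b), whereas τ = (u + d) / (2u + d) with d = m - n.
-- Cross-multiplying, P(E | R) ≥ τ gives d + 2m b ≤ a.  On the other hand the sets in R have total size
-- m - a and cover every ℓ whose Z-world was removed, so n ≤ b + (m - a), that is a ≤ d + b.
-- Together 2m b ≤ b, hence b = 0 and a = d.

open import Defs
open import Algebra.Bundles using (Ring)
open import Data.Bool using (Bool; true; false; not; _∧_; _∨_)
import Data.Bool as Bool
import Data.Bool.Properties as Bool
open import Data.Fin using (Fin; zero; suc)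
import Data.Fin as Fin
open import Data.Fin.Subset using (Subset; ∣_∣)
open import Data.Fin.Subset.Properties using (_∈?_)
open import Data.Integer using (+_)
import Data.Integer as ℤ
import Data.Integer.Properties as ℤ
open import Data.List using (List; []; _∷_; _++_; map; concatMap; filter; length; allFin; tabulate)
import Data.List.Properties as List
open import Data.List.Membership.Propositional using (_∈_)
open import Data.List.Membership.Propositional.Properties using (∈-allFin)
open import Data.List.Relation.Unary.Any using (here; there)
open import Data.Nat as ℕ using (ℕ; zero; suc; _+_; _*_; _∸_; NonZero)
import Data.Nat.Coprimality as Coprime
import Data.Nat.ListAction.Properties as ListAction
import Data.Nat.Properties as ℕ
open import Data.Nat.Tactic.RingSolver using (solve-∀)
open import Data.Product using (Σ; _,_; proj₁)
open import Data.Rational using (_≤_)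
open import Data.Rational as ℚ using (ℚ; mkℚ; 0ℚ; 1ℚ; Positive)
import Data.Rational.Properties as ℚ
open import Data.Rational.Solver using (module +-*-Solver)
import Data.Rational.Unnormalised as ℚᵘ
import Data.Rational.Unnormalised.Properties as ℚᵘ
open import Data.Vec using (_∷_; lookup)
import Data.Vec.Properties as Vec
open import Function using (_∘_; id)
open import Relation.Binary.PropositionalEquality
open import Relation.Nullary using (yes; no; does; contradiction)
open import Relation.Nullary.Decidable using (dec-true)

open import Algebra.Properties.CommutativeMonoid.Sum ℕ.+-0-commutativeMonoid
  using (sum-syntax; ∑-distrib-+; ∑-comm; sum-cong-≗; sum-replicate-zero)
open import Algebra.Properties.Semiring.Sum ℕ.+-*-semiring using (*-distribʳ-sum)
open import Algebra.Properties.Semiring.Mult (Ring.semiring ℚ.+-*-ring) using (_×_; ×-homo-+; ×1-homo-*)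

private variable
  X V : Set

coprime-1 : ∀ a → Coprime.Coprime a 1
coprime-1 a = Coprime.sym (Coprime.1-coprimeTo a)

ℕ→ℚ≡mkℚ : ∀ a → ℕ→ℚ a ≡ mkℚ (+ a) 0 (coprime-1 a)
ℕ→ℚ≡mkℚ a = ℚ.normalize-coprime (coprime-1 a)

ℕ→ℚ-suc : ∀ a → ℕ→ℚ (suc a) ≡ 1ℚ ℚ.+ ℕ→ℚ a
ℕ→ℚ-suc a rewrite ℕ→ℚ≡mkℚ (suc a) | ℕ→ℚ≡mkℚ a =
  ℚ.toℚᵘ-injective (ℚᵘ.≃-trans (ℚᵘ.*≡* numerators)
                                (ℚᵘ.≃-sym (ℚ.toℚᵘ-homo-+ 1ℚ (mkℚ (+ a) 0 (coprime-1 a)))))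
  where
  numerators : + suc a ℤ.* + 1 ≡ (+ 1 ℤ.* + 1 ℤ.+ + a ℤ.* + 1) ℤ.* + 1
  numerators = cong (λ t → (+ 1 ℤ.+ t) ℤ.* + 1) (sym (ℤ.*-identityʳ (+ a)))

ℕ→ℚ≡×1 : ∀ a → ℕ→ℚ a ≡ a × 1ℚ
ℕ→ℚ≡×1 zero    = refl
ℕ→ℚ≡×1 (suc a) = trans (ℕ→ℚ-suc a) (cong (1ℚ ℚ.+_) (ℕ→ℚ≡×1 a))

ℕ→ℚ-homo-+ : ∀ a b → ℕ→ℚ (a + b) ≡ ℕ→ℚ a ℚ.+ ℕ→ℚ b
ℕ→ℚ-homo-+ a b rewrite ℕ→ℚ≡×1 (a + b) | ℕ→ℚ≡×1 a | ℕ→ℚ≡×1 b = ×-homo-+ 1ℚ a b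

ℕ→ℚ-homo-* : ∀ a b → ℕ→ℚ (a * b) ≡ ℕ→ℚ a ℚ.* ℕ→ℚ b
ℕ→ℚ-homo-* a b rewrite ℕ→ℚ≡×1 (a * b) | ℕ→ℚ≡×1 a | ℕ→ℚ≡×1 b = ×1-homo-* a b

ℕ→ℚ-cancel-≤ : ∀ {a b} → ℕ→ℚ a ≤ ℕ→ℚ b → a ℕ.≤ b
ℕ→ℚ-cancel-≤ {a} {b} le rewrite ℕ→ℚ≡mkℚ a | ℕ→ℚ≡mkℚ b =
  ℤ.drop‿+≤+ (subst₂ ℤ._≤_ (ℤ.*-identityʳ (+ a)) (ℤ.*-identityʳ (+ b)) (ℚ.drop-*≤* le))

ℕ→ℚ-pos : ∀ a .{{_ : NonZero a}} → Positive (ℕ→ℚ a)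
ℕ→ℚ-pos a = ℚ.normalize-pos a 1

ℕ→ℚ-*-distribʳ-+ : ∀ a b w → ℕ→ℚ a ℚ.* w ℚ.+ ℕ→ℚ b ℚ.* w ≡ ℕ→ℚ (a + b) ℚ.* w
ℕ→ℚ-*-distribʳ-+ a b w =
  trans (sym (ℚ.*-distribʳ-+ w (ℕ→ℚ a) (ℕ→ℚ b))) (cong (ℚ._* w) (sym (ℕ→ℚ-homo-+ a b)))

ℕ→ℚ-*-assoc : ∀ a b w → ℕ→ℚ a ℚ.* (ℕ→ℚ b ℚ.* w) ≡ ℕ→ℚ (a * b) ℚ.* w
ℕ→ℚ-*-assoc a b w =
  trans (sym (ℚ.*-assoc (ℕ→ℚ a) (ℕ→ℚ b) w)) (cong (ℚ._* w) (sym (ℕ→ℚ-homo-* a b)))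

pos⇒≢0 : ∀ p .{{_ : Positive p}} → p ≢ 0ℚ
pos⇒≢0 p = ≢-sym (ℚ.<⇒≢ (ℚ.positive⁻¹ p))

÷'-*-cancel : ∀ p {q} → q ≢ 0ℚ → (p ÷' q) ℚ.* q ≡ p
÷'-*-cancel p {q} q≢0 with q ℚ.≟ 0ℚ
... | yes q≡0 = contradiction q≡0 q≢0
... | no q≢0′ = begin
  p ℚ.* ℚ.1/ q ℚ.* q     ≡⟨ ℚ.*-assoc p _ q ⟩
  p ℚ.* (ℚ.1/ q ℚ.* q)   ≡⟨ cong (p ℚ.*_) (ℚ.*-inverseˡ q) ⟩
  p ℚ.* 1ℚ               ≡⟨ ℚ.*-identityʳ p ⟩
  p                      ∎
  where
  open ≡-Reasoning
  instance _ = ℚ.≢-nonZero q≢0′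

÷'-pos : ∀ p q .{{_ : Positive p}} .{{_ : Positive q}} → Positive (p ÷' q)
÷'-pos p q = ℚ.positive (ℚ.*-cancelʳ-<-nonNeg q {{ℚ.pos⇒nonNeg q}} {0ℚ} {p ÷' q}
  (subst₂ ℚ._<_ (sym (ℚ.*-zeroˡ q)) (sym (÷'-*-cancel p (pos⇒≢0 q))) (ℚ.positive⁻¹ p)))

÷'-≤⇒cross-≤ : ∀ p q r s .{{_ : Positive q}} .{{_ : Positive s}} →
  p ÷' q ≤ r ÷' s → p ℚ.* s ≤ r ℚ.* q
÷'-≤⇒cross-≤ p q r s le = begin
  p ℚ.* s                   ≡⟨ clear p q s (pos⇒≢0 q) ⟨
  (p ÷' q) ℚ.* (q ℚ.* s)    ≤⟨ ℚ.*-monoʳ-≤-nonNeg (q ℚ.* s) {{qs-nonNeg}} le ⟩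
  (r ÷' s) ℚ.* (q ℚ.* s)    ≡⟨ cong ((r ÷' s) ℚ.*_) (ℚ.*-comm q s) ⟩
  (r ÷' s) ℚ.* (s ℚ.* q)    ≡⟨ clear r s q (pos⇒≢0 s) ⟩
  r ℚ.* q                   ∎
  where
  open ℚ.≤-Reasoning
  qs-nonNeg : ℚ.NonNegative (q ℚ.* s)
  qs-nonNeg = ℚ.pos⇒nonNeg (q ℚ.* s) {{ℚ.pos*pos⇒pos q s}}
  clear : ∀ a b c → b ≢ 0ℚ → (a ÷' b) ℚ.* (b ℚ.* c) ≡ a ℚ.* c
  clear a b c b≢0 = trans (sym (ℚ.*-assoc (a ÷' b) b c)) (cong (ℚ._* c) (÷'-*-cancel a b≢0))

scaled-÷'-≤⇒cross-≤ : ∀ p q r s w .{{_ : NonZero q}} .{{_ : NonZero s}} .{{_ : Positive w}} →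
  (ℕ→ℚ p ℚ.* w) ÷' (ℕ→ℚ q ℚ.* w) ≤ (ℕ→ℚ r ℚ.* w) ÷' (ℕ→ℚ s ℚ.* w) → p * s ℕ.≤ r * q
scaled-÷'-≤⇒cross-≤ p q r s w le = ℕ→ℚ-cancel-≤ (ℚ.*-cancelʳ-≤-pos (w ℚ.* w) {{ℚ.pos*pos⇒pos w w}}
  (subst₂ _≤_ (regroup p s) (regroup r q)
    (÷'-≤⇒cross-≤ (ℕ→ℚ p ℚ.* w) (ℕ→ℚ q ℚ.* w) (ℕ→ℚ r ℚ.* w) (ℕ→ℚ s ℚ.* w)
      {{ℚ.pos*pos⇒pos (ℕ→ℚ q) {{ℕ→ℚ-pos q}} w}}
      {{ℚ.pos*pos⇒pos (ℕ→ℚ s) {{ℕ→ℚ-pos s}} w}} le)))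
  where
  open +-*-Solver
  regroup : ∀ a b → (ℕ→ℚ a ℚ.* w) ℚ.* (ℕ→ℚ b ℚ.* w) ≡ ℕ→ℚ (a * b) ℚ.* (w ℚ.* w)
  regroup a b = trans
    (solve 3 (λ a b w → (a :* w) :* (b :* w) := (a :* b) :* (w :* w)) refl (ℕ→ℚ a) (ℕ→ℚ b) w)
    (cong (ℚ._* (w ℚ.* w)) (sym (ℕ→ℚ-homo-* a b)))

Bool→ℕ : Bool → ℕ
Bool→ℕ true  = 1
Bool→ℕ false = 0

sumℕ-map-++ : ∀ (f : X → ℕ) xs ys → sumℕ (map f (xs ++ ys)) ≡ sumℕ (map f xs) + sumℕ (map f ys)
sumℕ-map-++ f xs ys = trans (cong sumℕ (List.map-++ f xs ys)) (ListAction.sum-++ (map f xs) (map f ys))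

sumℕ-map-concatMap : ∀ (f : V → ℕ) (g : X → List V) xs →
  sumℕ (map f (concatMap g xs)) ≡ sumℕ (map (λ x → sumℕ (map f (g x))) xs)
sumℕ-map-concatMap f g []       = refl
sumℕ-map-concatMap f g (x ∷ xs) =
  trans (sumℕ-map-++ f (g x) (concatMap g xs)) (cong (_+_ (sumℕ (map f (g x)))) (sumℕ-map-concatMap f g xs))

sumℕ-map-filter : ∀ (T : X → Bool) (w : X → ℕ) xs →
  sumℕ (map w (filter (λ x → T x Bool.≟ true) xs)) ≡ sumℕ (map (λ x → Bool→ℕ (T x) * w x) xs)
sumℕ-map-filter T w []       = refl
sumℕ-map-filter T w (x ∷ xs) with T x
... | true  = cong₂ _+_ (sym (ℕ.+-identityʳ (w x))) (sumℕ-map-filter T w xs)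
... | false = sumℕ-map-filter T w xs

length-filter≡sumℕ : ∀ (T : X → Bool) xs →
  length (filter (λ x → T x Bool.≟ true) xs) ≡ sumℕ (map (Bool→ℕ ∘ T) xs)
length-filter≡sumℕ T []       = refl
length-filter≡sumℕ T (x ∷ xs) with T x
... | true  = cong suc (length-filter≡sumℕ T xs)
... | false = length-filter≡sumℕ T xs

sumℚ-map-scaled : ∀ {f : X → ℚ} {g : X → ℕ} {c} → (∀ x → f x ≡ ℕ→ℚ (g x) ℚ.* c) →
  ∀ xs → sumℚ (map f xs) ≡ ℕ→ℚ (sumℕ (map g xs)) ℚ.* c
sumℚ-map-scaled {c = c} f≡gc []       = sym (ℚ.*-zeroˡ c)
sumℚ-map-scaled {f = f} {g} {c} f≡gc (x ∷ xs) = begin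
  f x ℚ.+ sumℚ (map f xs)                             ≡⟨ cong₂ ℚ._+_ (f≡gc x) (sumℚ-map-scaled f≡gc xs) ⟩
  ℕ→ℚ (g x) ℚ.* c ℚ.+ ℕ→ℚ (sumℕ (map g xs)) ℚ.* c     ≡⟨ ℕ→ℚ-*-distribʳ-+ (g x) _ c ⟩
  ℕ→ℚ (g x + sumℕ (map g xs)) ℚ.* c                   ∎
  where open ≡-Reasoning

allB-true : ∀ (f : X → Bool) → (∀ x → f x ≡ true) → ∀ xs → allB f xs ≡ true
allB-true f f≡true []       = refl
allB-true f f≡true (x ∷ xs) rewrite f≡true x = allB-true f f≡true xs

allB-false : ∀ (f : X → Bool) {x xs} → x ∈ xs → f x ≡ false → allB f xs ≡ false
allB-false f {xs = y ∷ xs} (here refl) fx≡false rewrite fx≡false = refl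
allB-false f {xs = y ∷ xs} (there x∈xs) fx≡false rewrite allB-false f x∈xs fx≡false = Bool.∧-zeroʳ (f y)

sumℕ-map-allFin : ∀ {k} (f : Fin k → ℕ) → sumℕ (map f (allFin k)) ≡ ∑[ i < k ] f i
sumℕ-map-allFin f = trans (cong sumℕ (List.map-tabulate id f)) (sumℕ-tabulate f)
  where
  sumℕ-tabulate : ∀ {k} (f : Fin k → ℕ) → sumℕ (tabulate f) ≡ ∑[ i < k ] f i
  sumℕ-tabulate {zero}  f = refl
  sumℕ-tabulate {suc k} f = cong (_+_ (f zero)) (sumℕ-tabulate (f ∘ suc))

∑-mono-≤ : ∀ {k} {f g : Fin k → ℕ} → (∀ i → f i ℕ.≤ g i) → ∑[ i < k ] f i ℕ.≤ ∑[ i < k ] g i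
∑-mono-≤ {zero}  f≤g = ℕ.z≤n
∑-mono-≤ {suc k} f≤g = ℕ.+-mono-≤ (f≤g zero) (∑-mono-≤ (f≤g ∘ suc))

∑-one : ∀ n → ∑[ i < n ] 1 ≡ n
∑-one zero    = refl
∑-one (suc n) = cong suc (∑-one n)

term≤∑ : ∀ {k} (f : Fin k → ℕ) i → f i ℕ.≤ ∑[ j < k ] f j
term≤∑ f zero    = ℕ.m≤m+n (f zero) _
term≤∑ f (suc i) = ℕ.≤-trans (term≤∑ (f ∘ suc) i) (ℕ.m≤n+m _ (f zero))

∣p∣≡∑ : ∀ {n} (p : Subset n) → ∣ p ∣ ≡ ∑[ ℓ < n ] Bool→ℕ (lookup p ℓ)
∣p∣≡∑ Data.Vec.[]  = refl
∣p∣≡∑ (true ∷ p)  = cong suc (∣p∣≡∑ p)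
∣p∣≡∑ (false ∷ p) = ∣p∣≡∑ p

∑-split-by : ∀ {k} (f : Fin k → ℕ) (r : Fin k → Bool) →
  ∑[ i < k ] (f i * Bool→ℕ (not (r i))) + ∑[ i < k ] (f i * Bool→ℕ (r i)) ≡ ∑[ i < k ] f i
∑-split-by f r = trans (sym (∑-distrib-+ (λ i → f i * Bool→ℕ (not (r i))) (λ i → f i * Bool→ℕ (r i))))
                       (sum-cong-≗ λ i → split (f i) (r i))
  where
  split : ∀ a b → a * Bool→ℕ (not b) + a * Bool→ℕ b ≡ a
  split a true  = trans (cong (_+ a * 1) (ℕ.*-zeroʳ a)) (ℕ.*-identityʳ a)
  split a false = trans (cong₂ _+_ (ℕ.*-identityʳ a) (ℕ.*-zeroʳ a)) (ℕ.+-identityʳ a)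

+-nonZeroˡ : ∀ a b .{{_ : NonZero a}} → NonZero (a + b)
+-nonZeroˡ a b = ℕ.>-nonZero (ℕ.<-≤-trans (ℕ.>-nonZero⁻¹ a) (ℕ.m≤m+n a b))

threshold-cross-≤ : ∀ u d a b c .{{_ : NonZero u}} →
  (u + d) * (2 * u + (a + b * c)) ℕ.≤ (u + a) * (2 * u + d) → d + b * c ℕ.≤ a
threshold-cross-≤ u d a b c le = ℕ.*-cancelˡ-≤ u (begin
  u * (d + b * c)                  ≤⟨ ℕ.m≤m+n _ (d * (b * c)) ⟩
  u * (d + b * c) + d * (b * c)    ≤⟨ ℕ.+-cancelˡ-≤ common _ _ (subst₂ ℕ._≤_ (expandˡ u d a b c) (expandʳ u d a) le) ⟩
  u * a                            ∎)
  where
  open ℕ.≤-Reasoning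
  common : ℕ
  common = 2 * u * u + u * a + u * d + d * a
  expandˡ : ∀ u d a b c →
    (u + d) * (2 * u + (a + b * c)) ≡ (2 * u * u + u * a + u * d + d * a) + (u * (d + b * c) + d * (b * c))
  expandˡ = solve-∀
  expandʳ : ∀ u d a → (u + a) * (2 * u + d) ≡ (2 * u * u + u * a + u * d + d * a) + u * a
  expandʳ = solve-∀

squeeze : ∀ {a b c d} → 2 ℕ.≤ c → d + b * c ℕ.≤ a → a ℕ.≤ d + b → a ≡ d
squeeze {a} {zero}  {c} {d} _   d≤a a≤d      =
  ℕ.≤-antisym (subst (a ℕ.≤_) (ℕ.+-identityʳ d) a≤d) (subst (ℕ._≤ a) (ℕ.+-identityʳ d) d≤a)
squeeze {a} {suc b} {c} {d} 2≤c d+bc≤a a≤d+b =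
  contradiction (ℕ.+-cancelˡ-≤ d _ _ (ℕ.≤-trans d+bc≤a a≤d+b)) (ℕ.<⇒≱ (ℕ.m<m*n (suc b) c 2≤c))

excess≤ : ∀ {a b i m n} → n ℕ.≤ m → a + i ≡ m → n ℕ.≤ b + i → a ℕ.≤ m ∸ n + b
excess≤ {a} {b} {i} {m} {n} n≤m a+i≡m n≤b+i = ℕ.+-cancelʳ-≤ n a _ (begin
  a + n               ≤⟨ ℕ.+-monoʳ-≤ a n≤b+i ⟩
  a + (b + i)         ≡⟨ +-swap-last a b i ⟩
  a + i + b           ≡⟨ cong (_+ b) (trans a+i≡m (sym (ℕ.m∸n+n≡m n≤m))) ⟩
  m ∸ n + n + b       ≡⟨ ℕ.+-assoc (m ∸ n) n b ⟩
  m ∸ n + (n + b)     ≡⟨ +-swap-last (m ∸ n) n b ⟩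
  m ∸ n + b + n       ∎)
  where
  open ℕ.≤-Reasoning
  +-swap-last : ∀ x y z → x + (y + z) ≡ x + z + y
  +-swap-last = solve-∀

module Persuasion (n k : ℕ) (A : Fin k → Subset n) where

  open Construction n k A

  -- `Yrow i` concatMaps a function local to Defs (a where-clause); unification recovers it.
  Yrow≡concatMap : ∀ i → Σ (Fin n → List World) λ entries → Yrow i ≡ concatMap entries (allFin n)
  Yrow≡concatMap i = _ , refl

  entries : Fin k → Fin n → List World
  entries i = proj₁ (Yrow≡concatMap i)

  sumℕ-entries : ∀ (f : World → ℕ) {v} i ℓ → (∀ p → f (Y i ℓ p) ≡ v) →
    sumℕ (map f (entries i ℓ)) ≡ Bool→ℕ (lookup (A i) ℓ) * v
  sumℕ-entries f i ℓ f≡v with ℓ ∈? A i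
  ... | yes ℓ∈Aᵢ rewrite Vec.[]=⇒lookup ℓ∈Aᵢ = cong (_+ 0) (f≡v ℓ∈Aᵢ)
  ... | no ℓ∉Aᵢ with lookup (A i) ℓ in eq
  ...   | true  = contradiction (Vec.lookup⇒[]= ℓ (A i) eq) ℓ∉Aᵢ
  ...   | false = refl

  sumℕ-Yrow : ∀ (f : World → ℕ) {v} i → (∀ ℓ p → f (Y i ℓ p) ≡ v) →
    sumℕ (map f (Yrow i)) ≡ ∣ A i ∣ * v
  sumℕ-Yrow f {v} i f≡v = begin
    sumℕ (map f (Yrow i))                     ≡⟨ sumℕ-map-concatMap f (entries i) (allFin n) ⟩
    sumℕ (map entry-sum (allFin n))           ≡⟨ sumℕ-map-allFin entry-sum ⟩
    ∑[ ℓ < n ] entry-sum ℓ                    ≡⟨ sum-cong-≗ (λ ℓ → sumℕ-entries f i ℓ (f≡v ℓ)) ⟩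
    ∑[ ℓ < n ] (Bool→ℕ (lookup (A i) ℓ) * v)  ≡⟨ *-distribʳ-sum v (λ ℓ → Bool→ℕ (lookup (A i) ℓ)) ⟨
    (∑[ ℓ < n ] Bool→ℕ (lookup (A i) ℓ)) * v  ≡⟨ cong (_* v) (∣p∣≡∑ (A i)) ⟨
    ∣ A i ∣ * v                               ∎
    where
    open ≡-Reasoning
    entry-sum : Fin n → ℕ
    entry-sum ℓ = sumℕ (map f (entries i ℓ))

  sumℕ-Ω : ∀ (f : World → ℕ) (v : Fin k → ℕ) → (∀ i ℓ p → f (Y i ℓ p) ≡ v i) →
    sumℕ (map f Ω) ≡ f W0 + (f X0 + (∑[ i < k ] (∣ A i ∣ * v i) + ∑[ ℓ < n ] f (Z ℓ)))
  sumℕ-Ω f v f≡v = cong (λ t → f W0 + (f X0 + t)) (begin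
    sumℕ (map f (Ys ++ map Z (allFin n)))              ≡⟨ sumℕ-map-++ f Ys (map Z (allFin n)) ⟩
    sumℕ (map f Ys) + sumℕ (map f (map Z (allFin n)))  ≡⟨ cong₂ _+_ Y-part Z-part ⟩
    ∑[ i < k ] (∣ A i ∣ * v i) + ∑[ ℓ < n ] f (Z ℓ)    ∎)
    where
    open ≡-Reasoning
    Ys : List World
    Ys = concatMap Yrow (allFin k)
    Y-part : sumℕ (map f Ys) ≡ ∑[ i < k ] (∣ A i ∣ * v i)
    Y-part = trans (sumℕ-map-concatMap f Yrow (allFin k))
      (trans (sumℕ-map-allFin (λ i → sumℕ (map f (Yrow i)))) (sum-cong-≗ λ i → sumℕ-Yrow f i (f≡v i)))
    Z-part : sumℕ (map f (map Z (allFin n))) ≡ ∑[ ℓ < n ] f (Z ℓ)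
    Z-part = trans (cong sumℕ (sym (List.map-∘ (allFin n)))) (sumℕ-map-allFin (f ∘ Z))

  m≡∑∣A∣ : m ≡ ∑[ i < k ] ∣ A i ∣
  m≡∑∣A∣ = sumℕ-map-allFin (λ i → ∣ A i ∣)

  n≤m : ExactCoverInstance n k A → n ℕ.≤ m
  n≤m cover = begin
    n                                                ≡⟨ ∑-one n ⟨
    ∑[ ℓ < n ] 1                                     ≤⟨ ∑-mono-≤ covered ⟩
    ∑[ ℓ < n ] (∑[ i < k ] Bool→ℕ (lookup (A i) ℓ))  ≡⟨ ∑-comm (λ ℓ i → Bool→ℕ (lookup (A i) ℓ)) ⟩
    ∑[ i < k ] (∑[ ℓ < n ] Bool→ℕ (lookup (A i) ℓ))  ≡⟨ sum-cong-≗ (λ i → ∣p∣≡∑ (A i)) ⟨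
    ∑[ i < k ] ∣ A i ∣                               ≡⟨ m≡∑∣A∣ ⟨
    m                                                ∎
    where
    open ℕ.≤-Reasoning
    covered : ∀ ℓ → 1 ℕ.≤ ∑[ i < k ] Bool→ℕ (lookup (A i) ℓ)
    covered ℓ with ExactCoverInstance.covers cover ℓ
    ... | i , ℓ∈Aᵢ =
      subst (λ b → Bool→ℕ b ℕ.≤ _) (Vec.[]=⇒lookup ℓ∈Aᵢ) (term≤∑ (λ i → Bool→ℕ (lookup (A i) ℓ)) i)

  m-n≡+[m∸n] : n ℕ.≤ m → m-n ≡ + (m ∸ n)
  m-n≡+[m∸n] n≤m = trans (ℤ.[+m]-[+n]≡m⊖n m n) (ℤ.⊖-≥ n≤m)

  u : ℕ
  u = m * (1 + 2 * n)

  weight : World → ℕ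
  weight W0        = u
  weight X0        = u
  weight (Y _ _ _) = 1
  weight (Z _)     = 2 * m

  module _ .{{_ : NonZero m}} where

    instance
      u-nonZero : NonZero u
      u-nonZero = ℕ.m*n≢0 m (1 + 2 * n)

    2u+-nonZero : ∀ t → NonZero (2 * u + t)
    2u+-nonZero t = +-nonZeroˡ (2 * u) t {{ℕ.m*n≢0 2 u}}

    -- Uses 1 - 2x = x, which holds for x = 1/3 by evaluation.
    x≡u*y : x ≡ ℕ→ℚ u ℚ.* y
    x≡u*y = trans (sym (÷'-*-cancel x (pos⇒≢0 (ℕ→ℚ u) {{ℕ→ℚ-pos u}}))) (ℚ.*-comm y (ℕ→ℚ u))

    y-pos : Positive y
    y-pos = ÷'-pos x (ℕ→ℚ u) {{_}} {{ℕ→ℚ-pos u}}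

    π≡weight*y : ∀ ω → π ω ≡ ℕ→ℚ (weight ω) ℚ.* y
    π≡weight*y W0        = x≡u*y
    π≡weight*y X0        = x≡u*y
    π≡weight*y (Y _ _ _) = sym (ℚ.*-identityˡ y)
    π≡weight*y (Z _)     = refl

    π*≡ : ∀ T → π* T ≡ ℕ→ℚ (sumℕ (map (λ ω → Bool→ℕ (T ω) * weight ω) Ω)) ℚ.* y
    π*≡ T = trans (sumℚ-map-scaled π≡weight*y (filter (λ ω → T ω Bool.≟ true) Ω))
                  (cong (λ t → ℕ→ℚ t ℚ.* y) (sumℕ-map-filter T weight Ω))

    τ≡ : n ℕ.≤ m → τ ≡ (ℕ→ℚ (u + (m ∸ n)) ℚ.* y) ÷' (ℕ→ℚ (2 * u + (m ∸ n)) ℚ.* y)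
    τ≡ n≤m = cong₂ _÷'_
      (begin
        x ℚ.+ (m-n ℚ./ 1) ℚ.* y                        ≡⟨ cong₂ (λ a b → a ℚ.+ (b ℚ./ 1) ℚ.* y) x≡u*y m-n≡d ⟩
        ℕ→ℚ u ℚ.* y ℚ.+ ℕ→ℚ d ℚ.* y                    ≡⟨ ℕ→ℚ-*-distribʳ-+ u d y ⟩
        ℕ→ℚ (u + d) ℚ.* y                              ∎)
      (begin
        ℕ→ℚ 2 ℚ.* x ℚ.+ (m-n ℚ./ 1) ℚ.* y              ≡⟨ cong₂ (λ a b → ℕ→ℚ 2 ℚ.* a ℚ.+ (b ℚ./ 1) ℚ.* y) x≡u*y m-n≡d ⟩
        ℕ→ℚ 2 ℚ.* (ℕ→ℚ u ℚ.* y) ℚ.+ ℕ→ℚ d ℚ.* y        ≡⟨ cong (ℚ._+ ℕ→ℚ d ℚ.* y) (ℕ→ℚ-*-assoc 2 u y) ⟩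
        ℕ→ℚ (2 * u) ℚ.* y ℚ.+ ℕ→ℚ d ℚ.* y              ≡⟨ ℕ→ℚ-*-distribʳ-+ (2 * u) d y ⟩
        ℕ→ℚ (2 * u + d) ℚ.* y                          ∎)
      where
      open ≡-Reasoning
      d : ℕ
      d = m ∸ n
      m-n≡d : m-n ≡ + d
      m-n≡d = m-n≡+[m∸n] n≤m

  module _ (R : Subset k) where

    inCap-W0 : inCap R W0 ≡ true
    inCap-W0 = allB-true _ (λ i → Bool.∨-zeroʳ (not (lookup R i))) (allFin k)

    inCap-X0 : inCap R X0 ≡ true
    inCap-X0 = allB-true _ (λ i → Bool.∨-zeroʳ (not (lookup R i))) (allFin k)

    inCap-Y : ∀ i ℓ p → inCap R (Y i ℓ p) ≡ not (lookup R i)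
    inCap-Y i ℓ p with lookup R i in Rᵢ
    ... | false = allB-true _ kept (allFin k)
      where
      kept : ∀ j → (not (lookup R j) ∨ not (does (j Fin.≟ i))) ≡ true
      kept j with j Fin.≟ i
      ... | yes refl rewrite Rᵢ = refl
      ... | no _     = Bool.∨-zeroʳ (not (lookup R j))
    ... | true  = allB-false _ (∈-allFin i)
      (subst (λ b → (not b ∨ not (does (i Fin.≟ i))) ≡ false) (sym Rᵢ) (cong not (dec-true (i Fin.≟ i) refl)))

    #Z∩ : ℕ
    #Z∩ = ∑[ ℓ < n ] Bool→ℕ (inCap R (Z ℓ))

    ∑∣A∣∉R ∑∣A∣∈R : ℕ
    ∑∣A∣∉R = ∑[ i < k ] (∣ A i ∣ * Bool→ℕ (not (lookup R i)))
    ∑∣A∣∈R = ∑[ i < k ] (∣ A i ∣ * Bool→ℕ (lookup R i))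

    #Y∩≡∑∣A∣∉R : #Y∩ R ≡ ∑∣A∣∉R
    #Y∩≡∑∣A∣∉R = begin
      #Y∩ R                               ≡⟨ length-filter≡sumℕ Y∩⋂R Ω ⟩
      sumℕ (map (Bool→ℕ ∘ Y∩⋂R) Ω)        ≡⟨ sumℕ-Ω (Bool→ℕ ∘ Y∩⋂R) (λ i → Bool→ℕ (not (lookup R i))) Y-value ⟩
      0 + (0 + (∑∣A∣∉R + ∑[ ℓ < n ] 0))   ≡⟨ cong (_+_ ∑∣A∣∉R) (sum-replicate-zero n) ⟩
      ∑∣A∣∉R + 0                          ≡⟨ ℕ.+-identityʳ ∑∣A∣∉R ⟩
      ∑∣A∣∉R                              ∎
      where
      open ≡-Reasoning
      Y∩⋂R : World → Bool
      Y∩⋂R ω = isY ω ∧ inCap R ω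
      Y-value : ∀ i ℓ p → Bool→ℕ (Y∩⋂R (Y i ℓ p)) ≡ Bool→ℕ (not (lookup R i))
      Y-value i ℓ p = cong Bool→ℕ (inCap-Y i ℓ p)

    #Y∩+∑∣A∣∈R≡m : #Y∩ R + ∑∣A∣∈R ≡ m
    #Y∩+∑∣A∣∈R≡m = begin
      #Y∩ R + ∑∣A∣∈R      ≡⟨ cong (_+ ∑∣A∣∈R) #Y∩≡∑∣A∣∉R ⟩
      ∑∣A∣∉R + ∑∣A∣∈R     ≡⟨ ∑-split-by (λ i → ∣ A i ∣) (lookup R) ⟩
      ∑[ i < k ] ∣ A i ∣  ≡⟨ m≡∑∣A∣ ⟨
      m                   ∎
      where open ≡-Reasoning

    n≤#Z∩+∑∣A∣∈R : n ℕ.≤ #Z∩ + ∑∣A∣∈R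
    n≤#Z∩+∑∣A∣∈R = begin
      n                                                          ≡⟨ ∑-one n ⟨
      ∑[ ℓ < n ] 1                                               ≤⟨ ∑-mono-≤ uncovered-or-covered ⟩
      ∑[ ℓ < n ] (Bool→ℕ (inCap R (Z ℓ)) + ∑[ i < k ] hit i ℓ)   ≡⟨ ∑-distrib-+ _ (λ ℓ → ∑[ i < k ] hit i ℓ) ⟩
      #Z∩ + ∑[ ℓ < n ] (∑[ i < k ] hit i ℓ)                      ≡⟨ cong (_+_ #Z∩) (∑-comm (λ ℓ i → hit i ℓ)) ⟩
      #Z∩ + ∑[ i < k ] (∑[ ℓ < n ] hit i ℓ)                      ≡⟨ cong (_+_ #Z∩) (sum-cong-≗ hits-of) ⟩
      #Z∩ + ∑∣A∣∈R                                               ∎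
      where
      open ℕ.≤-Reasoning
      hit : Fin k → Fin n → ℕ
      hit i ℓ = Bool→ℕ (lookup (A i) ℓ) * Bool→ℕ (lookup R i)
      hits-of : ∀ i → ∑[ ℓ < n ] hit i ℓ ≡ ∣ A i ∣ * Bool→ℕ (lookup R i)
      hits-of i = trans (sym (*-distribʳ-sum (Bool→ℕ (lookup R i)) (λ ℓ → Bool→ℕ (lookup (A i) ℓ))))
                        (cong (_* Bool→ℕ (lookup R i)) (sym (∣p∣≡∑ (A i))))
      uncovered-or-covered-in : ∀ (a : Fin k → Bool) is →
        1 ℕ.≤ Bool→ℕ (allB (λ i → not (lookup R i) ∨ not (a i)) is)
              + sumℕ (map (λ i → Bool→ℕ (a i) * Bool→ℕ (lookup R i)) is)
      uncovered-or-covered-in a []       = ℕ.≤-refl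
      uncovered-or-covered-in a (i ∷ is) with lookup R i | a i
      ... | true  | true  = ℕ.s≤s ℕ.z≤n
      ... | true  | false = uncovered-or-covered-in a is
      ... | false | true  = uncovered-or-covered-in a is
      ... | false | false = uncovered-or-covered-in a is
      uncovered-or-covered : ∀ ℓ → 1 ℕ.≤ Bool→ℕ (inCap R (Z ℓ)) + ∑[ i < k ] hit i ℓ
      uncovered-or-covered ℓ =
        subst (λ t → 1 ℕ.≤ Bool→ℕ (inCap R (Z ℓ)) + t) (sumℕ-map-allFin (λ i → hit i ℓ))
              (uncovered-or-covered-in (λ i → lookup (A i) ℓ) (allFin k))

    #Y∩≤m∸n+#Z∩ : n ℕ.≤ m → #Y∩ R ℕ.≤ m ∸ n + #Z∩
    #Y∩≤m∸n+#Z∩ n≤m = excess≤ n≤m #Y∩+∑∣A∣∈R≡m n≤#Z∩+∑∣A∣∈R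

    weight-E∩⋂R : sumℕ (map (λ ω → Bool→ℕ (inE ω ∧ inCap R ω) * weight ω) Ω) ≡ u + #Y∩ R
    weight-E∩⋂R = begin
      sumℕ (map (λ ω → Bool→ℕ (inE ω ∧ inCap R ω) * weight ω) Ω)
        ≡⟨ sumℕ-Ω (λ ω → Bool→ℕ (inE ω ∧ inCap R ω) * weight ω) (λ i → Bool→ℕ (not (lookup R i)))
                  (λ i ℓ p → trans (ℕ.*-identityʳ _) (cong Bool→ℕ (inCap-Y i ℓ p))) ⟩
      Bool→ℕ (inCap R W0) * u + (0 + (∑∣A∣∉R + ∑[ ℓ < n ] 0))
        ≡⟨ cong₂ (λ b t → Bool→ℕ b * u + (∑∣A∣∉R + t)) inCap-W0 (sum-replicate-zero n) ⟩
      1 * u + (∑∣A∣∉R + 0)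
        ≡⟨ cong₂ _+_ (ℕ.*-identityˡ u) (trans (ℕ.+-identityʳ ∑∣A∣∉R) (sym #Y∩≡∑∣A∣∉R)) ⟩
      u + #Y∩ R
        ∎
      where open ≡-Reasoning

    weight-⋂R : sumℕ (map (λ ω → Bool→ℕ (inCap R ω) * weight ω) Ω) ≡ 2 * u + (#Y∩ R + #Z∩ * (2 * m))
    weight-⋂R = begin
      sumℕ (map (λ ω → Bool→ℕ (inCap R ω) * weight ω) Ω)
        ≡⟨ sumℕ-Ω (λ ω → Bool→ℕ (inCap R ω) * weight ω) (λ i → Bool→ℕ (not (lookup R i)))
                  (λ i ℓ p → trans (ℕ.*-identityʳ _) (cong Bool→ℕ (inCap-Y i ℓ p))) ⟩
      Bool→ℕ (inCap R W0) * u + (Bool→ℕ (inCap R X0) * u + (∑∣A∣∉R + Z-part))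
        ≡⟨ cong₂ (λ b b′ → Bool→ℕ b * u + (Bool→ℕ b′ * u + (∑∣A∣∉R + Z-part))) inCap-W0 inCap-X0 ⟩
      1 * u + (1 * u + (∑∣A∣∉R + Z-part))
        ≡⟨ cong (λ t → 1 * u + (1 * u + (∑∣A∣∉R + t))) (*-distribʳ-sum (2 * m) (Bool→ℕ ∘ inCap R ∘ Z)) ⟨
      1 * u + (1 * u + (∑∣A∣∉R + #Z∩ * (2 * m)))
        ≡⟨ twice u (∑∣A∣∉R + #Z∩ * (2 * m)) ⟩
      2 * u + (∑∣A∣∉R + #Z∩ * (2 * m))
        ≡⟨ cong (λ a → 2 * u + (a + #Z∩ * (2 * m))) #Y∩≡∑∣A∣∉R ⟨
      2 * u + (#Y∩ R + #Z∩ * (2 * m))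
        ∎
      where
      open ≡-Reasoning
      Z-part : ℕ
      Z-part = ∑[ ℓ < n ] (Bool→ℕ (inCap R (Z ℓ)) * (2 * m))
      twice : ∀ u t → 1 * u + (1 * u + t) ≡ 2 * u + t
      twice = solve-∀

    P[E∣R]≡ : .{{_ : NonZero m}} →
      P[E∣ R ] ≡ (ℕ→ℚ (u + #Y∩ R) ℚ.* y) ÷' (ℕ→ℚ (2 * u + (#Y∩ R + #Z∩ * (2 * m))) ℚ.* y)
    P[E∣R]≡ = cong₂ _÷'_
      (trans (π*≡ (λ ω → inE ω ∧ inCap R ω)) (cong (λ t → ℕ→ℚ t ℚ.* y) weight-E∩⋂R))
      (trans (π*≡ (inCap R)) (cong (λ t → ℕ→ℚ t ℚ.* y) weight-⋂R))

    τ≤P⇒m∸n+#Z∩*2m≤#Y∩ : .{{_ : NonZero m}} → n ℕ.≤ m → τ ≤ P[E∣ R ] →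
      m ∸ n + #Z∩ * (2 * m) ℕ.≤ #Y∩ R
    τ≤P⇒m∸n+#Z∩*2m≤#Y∩ n≤m τ≤P = threshold-cross-≤ u (m ∸ n) (#Y∩ R) #Z∩ (2 * m)
      (scaled-÷'-≤⇒cross-≤ (u + (m ∸ n)) (2 * u + (m ∸ n)) (u + #Y∩ R) (2 * u + (#Y∩ R + #Z∩ * (2 * m))) y
        {{2u+-nonZero _}} {{2u+-nonZero _}} {{y-pos}} (subst₂ _≤_ (τ≡ n≤m) P[E∣R]≡ τ≤P))

  #Y∩≡m∸n : ExactCoverInstance n k A → ∀ R → τ ≤ P[E∣ R ] → #Y∩ R ≡ m ∸ n
  #Y∩≡m∸n cover R τ≤P with m ℕ.≟ 0
  -- Here y = _ ÷' 0 is a junk value, but there are no Y-worlds at all.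
  ... | yes m≡0 =
    trans (ℕ.n≤0⇒n≡0 (subst (#Y∩ R ℕ.≤_) m≡0 #Y∩≤m)) (sym (trans (cong (_∸ n) m≡0) (ℕ.0∸n≡0 n)))
    where
    #Y∩≤m : #Y∩ R ℕ.≤ m
    #Y∩≤m = subst (#Y∩ R ℕ.≤_) (#Y∩+∑∣A∣∈R≡m R) (ℕ.m≤m+n (#Y∩ R) (∑∣A∣∈R R))
  ... | no m≢0 = squeeze (ℕ.*-monoʳ-≤ 2 (ℕ.>-nonZero⁻¹ m))
                         (τ≤P⇒m∸n+#Z∩*2m≤#Y∩ R (n≤m cover) τ≤P)
                         (#Y∩≤m∸n+#Z∩ R (n≤m cover))
    where instance _ = ℕ.≢-nonZero m≢0

mainTheorem5 : (n k : ℕ) (A : Fin k → Subset n) → ExactCoverInstance n k A →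
    (R : Subset k) → Construction.τ n k A ≤ Construction.P[E∣_] n k A R →
    + Construction.#Y∩ n k A R ≡ Construction.m-n n k A
mainTheorem5 n k A cover R τ≤P = begin
  + #Y∩ R       ≡⟨ cong +_ (#Y∩≡m∸n cover R τ≤P) ⟩
  + (m ∸ n)     ≡⟨ m-n≡+[m∸n] (n≤m cover) ⟨
  m-n           ∎
  where
  open Construction n k A
  open Persuasion n k A
  open ≡-Reasoning
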